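{- Let $q$ be a prime power. Let $\ell,m$ be two distinct non-tangent lines of $\mathcal O$ in $\mathrm{PG}(2,q)$, and let $\rho(\ell,m)=\{\lambda,\lambda^{ -1}\}$ with $\lambda\in\mathbb F_{q^2}\cup\{\infty\}$. - If $\ell$ and $m$ are of the same type, then $\lambda\in\mathbf B_0$. - If $\ell$ and $m$ are of different type, then $\lambda\in\mathbf B_1$.
   Context: Let $q$ be a prime power. Projective plane and conic. - Points are nonzero column vectors up to scalars, and $\mathrm{PG}(2,q)\subset\mathrm{PG}(2,q^2)$. - $P_\xi=(\xi,\xi^2,1)^\top$ and $P_\infty=(0,1,0)^\top$. - $\mathcal O_{q^m}=\{P_\xi:\xi\in\mathbb F_{q^m}\cup\{\infty\}\}$, and $\mathcal O=\mathcal O_q$. Line types. - A non-tangent line of $\mathrm{PG}(2,q)$ meets $\mathcal O$ in $2$ points (type hyperbolic) or $0$ points (type elliptic). - Viewed in $\mathrm{PG}(2,q^2)$, it meets $\mathcal O_{q^2}$ in exactly two points $P_\alpha,P_\beta$. Cross-ratio. - With $v_x=(x,1)^\top$ and $v_\infty=(1,0)^\top$, $\rho(\alpha,\beta,\gamma,\delta)$ (no three equal) is the point $(\det(v_\alpha,v_\gamma)\det(v_\beta,v_\delta),\ \det(v_\alpha,v_\delta)\det(v_\beta,v_\gamma))^\top$ of $\mathrm{PG}(1,q^2)=\mathbb F_{q^2}\cup\{\infty\}$. For finite entries this equals $\frac{(\alpha-\gamma)(\beta-\delta)}{(\alpha-\delta)(\beta-\gamma)}$. - For distinct non-tangent lines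 with $\ell\cap\mathcal O_{q^2}=\{P_\alpha,P_\beta\}$ and $m\cap\mathcal O_{q^2}=\{P_\gamma,P_\delta\}$, $\rho(\ell,m)=\{r,r^{ -1}\}$ with $r=\rho(\alpha,\beta,\gamma,\delta)$, where $0^{ -1}=\infty$. Parameter sets. - $\mathbf B_0=(\mathbb F_q\cup\{\infty\})\setminus\{1\}$. - $\mathbf B_1=\{x\in\mathbb F_{q^2}\setminus\{1\}:x^q=x^{ -1}\}$. -}

module Defs where

open import Level using (Level; _⊔_)
open import Algebra.Bundles using (CommutativeRing)
open import Data.Nat using (ℕ; suc) renaming (_^_ to _^ℕ_)
open import Data.Nat.Primality using (Prime)
open import Data.Maybe using (Maybe; just; nothing)
open import Data.List using (List; length)
open import Data.List.Relation.Unary.Any using (Any)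
open import Data.List.Relation.Unary.AllPairs using (AllPairs)
open import Data.Product using (Σ; _×_; _,_)
open import Data.Sum using (_⊎_)
open import Data.Unit.Polymorphic using (⊤)
open import Relation.Nullary using (¬_)
open import Relation.Binary.PropositionalEquality using (_≡_)

IsPrimePower : ℕ → Set
IsPrimePower q = Σ ℕ λ p → Σ ℕ λ k → Prime p × q ≡ p ^ℕ suc k

record IsFiniteFieldOfOrder {c ℓ : Level} (F : CommutativeRing c ℓ) (n : ℕ) : Set (c ⊔ ℓ) where
  open CommutativeRing F
  field
    1≉0     : ¬ (1# ≈ 0#)
    inverse : ∀ x → ¬ (x ≈ 0#) → Σ Carrier λ y → x * y ≈ 1#
    enum    : List Carrier
    enum-length   : length enum ≡ n
    enum-complete : ∀ x → Any (x ≈_) enum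
    enum-distinct : AllPairs (λ a b → ¬ (a ≈ b)) enum

-- Geometry over F = F_{q²}; F_q is the subfield {x | x^q = x}.
module Geometry {c ℓ : Level} (F : CommutativeRing c ℓ) (q : ℕ) where
  open CommutativeRing F

  infixr 8 _^_
  _^_ : Carrier → ℕ → Carrier
  x ^ ℕ.zero  = 1#
  x ^ ℕ.suc n = x * (x ^ n)

  InFq : Carrier → Set ℓ
  InFq x = x ^ q ≈ x

  -- F_{q²} ∪ {∞} = PG(1,q²) in affine form; nothing = ∞
  Param : Set c
  Param = Maybe Carrier

  _≈ₚ_ : Param → Param → Set ℓ
  just x  ≈ₚ just y  = x ≈ y
  just _  ≈ₚ nothing = Data.Empty.Polymorphic.⊥
    where import Data.Empty.Polymorphic
  nothing ≈ₚ just _  = Data.Empty.Polymorphic.⊥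
    where import Data.Empty.Polymorphic
  nothing ≈ₚ nothing = ⊤

  -- parameters of points of 𝒪 = 𝒪_q : F_q ∪ {∞}
  InFqParam : Param → Set ℓ
  InFqParam (just x) = InFq x
  InFqParam nothing  = ⊤

  -- a line of PG(2,q): {X | a X₀ + b X₁ + c X₂ = 0} with (a,b,c) ∈ F_q³ nonzero
  record Line : Set (c ⊔ ℓ) where
    constructor mkLine
    field
      a b d    : Carrier
      a∈Fq     : InFq a
      b∈Fq     : InFq b
      d∈Fq     : InFq d
      nonzero  : ¬ (a ≈ 0# × b ≈ 0# × d ≈ 0#)

  SameLine : Line → Line → Set (c ⊔ ℓ)
  SameLine L M = Σ Carrier λ k →
    (k * Line.a L ≈ Line.a M) × (k * Line.b L ≈ Line.b M) × (k * Line.d L ≈ Line.d M)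

  -- P_ξ = (ξ, ξ², 1) and P_∞ = (0,1,0) lies on L
  OnLine : Line → Param → Set ℓ
  OnLine L (just x) = Line.a L * x + Line.b L * (x * x) + Line.d L ≈ 0#
  OnLine L nothing  = Line.b L ≈ 0#

  Hyperbolic : Line → Set (c ⊔ ℓ)
  Hyperbolic L = Σ Param λ ξ₁ → Σ Param λ ξ₂ →
    InFqParam ξ₁ × InFqParam ξ₂ × ¬ (ξ₁ ≈ₚ ξ₂) × OnLine L ξ₁ × OnLine L ξ₂ ×
    (∀ ξ → InFqParam ξ → OnLine L ξ → (ξ ≈ₚ ξ₁) ⊎ (ξ ≈ₚ ξ₂))

  Elliptic : Line → Set (c ⊔ ℓ)
  Elliptic L = ∀ ξ → InFqParam ξ → ¬ OnLine L ξ

  NonTangent : Line → Set (c ⊔ ℓ)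
  NonTangent L = Hyperbolic L ⊎ Elliptic L

  SameType : Line → Line → Set (c ⊔ ℓ)
  SameType L M = (Hyperbolic L × Hyperbolic M) ⊎ (Elliptic L × Elliptic M)

  DifferentType : Line → Line → Set (c ⊔ ℓ)
  DifferentType L M = (Hyperbolic L × Elliptic M) ⊎ (Elliptic L × Hyperbolic M)

  MeetsConicIn : Line → Param → Param → Set (c ⊔ ℓ)
  MeetsConicIn L α β = ¬ (α ≈ₚ β) × OnLine L α × OnLine L β ×
    (∀ ξ → OnLine L ξ → (ξ ≈ₚ α) ⊎ (ξ ≈ₚ β))

  vec : Param → Carrier × Carrier
  vec (just x) = x , 1#
  vec nothing  = 1# , 0#

  det : Carrier × Carrier → Carrier × Carrier → Carrier
  det (x₁ , y₁) (x₂ , y₂) = x₁ * y₂ + - (y₁ * x₂)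

  crossRatioHom : Param → Param → Param → Param → Carrier × Carrier
  crossRatioHom α β γ δ =
    det (vec α) (vec γ) * det (vec β) (vec δ) , det (vec α) (vec δ) * det (vec β) (vec γ)

  Represents : Carrier × Carrier → Param → Set ℓ
  Represents (n , d) (just x) = ¬ (d ≈ 0#) × n ≈ x * d
  Represents (n , d) nothing  = ¬ (n ≈ 0#) × d ≈ 0#

  swap : Carrier × Carrier → Carrier × Carrier
  swap (n , d) = d , n

  InB0 : Param → Set ℓ
  InB0 (just x) = InFq x × ¬ (x ≈ 1#)
  InB0 nothing  = ⊤

  -- B₁ = {x ∈ F_{q²} \ {1} : x^q = x⁻¹}   (x^q = x⁻¹ written as x^q · x = 1)
  InB1 : Param → Set ℓ
  InB1 (just x) = ¬ (x ≈ 1#) × (x ^ q) * x ≈ 1#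
  InB1 nothing  = Data.Empty.Polymorphic.⊥
    where import Data.Empty.Polymorphic

module Submission where

-- Let φ x = x ^ q, the Frobenius automorphism of F_{q²} over F_q.  A line of PG(2,q) has
-- coefficients in F_q, so φ maps the two points P_α, P_β where it meets 𝒪_{q²} to
-- points of the same line: it fixes them when the line is hyperbolic (they lie on 𝒪)
-- and swaps them when it is elliptic (a fixed point would lie on 𝒪).  The homogeneous
-- cross-ratio (n , d) is a polynomial in the coordinates, so φ maps it to the
-- cross-ratio of the images; exchanging one of the pairs exchanges n and d, exchanging
-- both pairs leaves them unchanged.  So for lines of the same type λ is fixed by φ,
-- i.e. λ ∈ F_q ∪ {∞}, and for lines of different type λ ^ q = λ⁻¹.  Finally λ ≠ 1
-- because, by the Plücker identity, n - d = det(α,β) det(γ,δ) ≠ 0.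
--
-- That φ is additive rests on p · 1 = 0 in the field, as p divides the inner binomial
-- coefficients of (x + y) ^ p.

open import Defs
open import Level using (Level)
open import Algebra.Bundles using (CommutativeRing; CommutativeSemiring)
open import Data.Nat as ℕ using (ℕ; zero; suc; _<_; _!; s≤s; z≤n)
import Data.Nat.Properties as ℕₚ
open import Data.Nat.Divisibility using (_∣_; _∤_; divides-refl; >⇒∤; ∣1⇒≡1; m∣m*n)
open import Data.Nat.DivMod using (m/n*n≡m)
open import Data.Nat.Primality using (Prime; euclidsLemma; ¬prime[0]; ¬prime[1])
open import Data.Nat.Combinatorics using (_C_; nCn≡1; k![n∸k]!∣n!)
open import Data.Nat.Combinatorics.Specification using (nCk≡n!/k![n-k]!)
open import Data.Fin as Fin using (Fin; toℕ; inject₁; fromℕ)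
open import Data.Fin.Properties using (toℕ-inject₁; toℕ<n; toℕ-fromℕ)
open import Data.Fin.Permutation using (Permutation; permutation)
open import Data.List using (List; length; lookup)
open import Data.List.Relation.Unary.Any as Any using ()
open import Data.List.Relation.Unary.Any.Properties using (lookup-index)
import Data.List.Relation.Unary.All as All
open import Data.List.Relation.Unary.AllPairs using (AllPairs; _∷_)
open import Data.List.Membership.Setoid.Properties using (index-injective)
open import Data.List.Membership.Propositional.Properties using (∈-lookup)
open import Data.Maybe as Maybe using (just; nothing)
open import Data.Product as Product using (_,_; proj₁; proj₂)
open import Data.Product.Relation.Binary.Pointwise.NonDependent using (Pointwise)
open import Data.Sum using (_⊎_; inj₁; inj₂; [_,_]′)
open import Data.Unit.Polymorphic using (tt)
open import Function using (id; _∘_)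
open import Relation.Binary.Bundles using (Setoid)
open import Relation.Binary.Definitions using (Decidable)
open import Relation.Binary.PropositionalEquality as ≡ using (_≡_)
open import Relation.Nullary using (¬_; yes; no; contradiction)
open import Relation.Nullary.Decidable using (map′)
open import Tactic.RingSolver using (solve-∀)
open import Tactic.RingSolver.Core.AlmostCommutativeRing using (AlmostCommutativeRing; fromCommutativeRing)

n∣n! : ∀ {n} → 0 < n → n ∣ n !
n∣n! {suc n} _ = m∣m*n (n !)

prime∤! : ∀ {p m} → Prime p → m < p → p ∤ m !
prime∤! {m = zero}  p-prime _   p∣1  = ¬prime[1] (≡.subst Prime (∣1⇒≡1 p∣1) p-prime)
prime∤! {m = suc m} p-prime m<p p∣m! =
  [ >⇒∤ m<p , prime∤! p-prime (ℕₚ.<-trans (ℕₚ.n<1+n m) m<p) ]′ (euclidsLemma (suc m) (m !) p-prime p∣m!)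

prime∣C : ∀ {p k} → Prime p → 0 < k → k < p → p ∣ p C k
prime∣C {p} {k} p-prime 0<k k<p =
  [ id , (λ p∣k![p∸k]! → contradiction p∣k![p∸k]! p∤k![p∸k]!) ]′
    (euclidsLemma (p C k) (k ! ℕ.* (p ℕ.∸ k) !) p-prime
      (≡.subst (p ∣_) (≡.sym C*k![p∸k]!≡p!) (n∣n! (ℕₚ.<-trans 0<k k<p))))
  where
  instance
    k![p∸k]!≢0 : ℕ.NonZero (k ! ℕ.* (p ℕ.∸ k) !)
    k![p∸k]!≢0 = ℕₚ._!*_!≢0 k (p ℕ.∸ k)
  C*k![p∸k]!≡p! : (p C k) ℕ.* (k ! ℕ.* (p ℕ.∸ k) !) ≡ p !
  C*k![p∸k]!≡p! = ≡.trans (≡.cong (ℕ._* (k ! ℕ.* (p ℕ.∸ k) !)) (nCk≡n!/k![n-k]! (ℕₚ.<⇒≤ k<p)))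
                          (m/n*n≡m (k![n∸k]!∣n! (ℕₚ.<⇒≤ k<p)))
  p∤k![p∸k]! : p ∤ k ! ℕ.* (p ℕ.∸ k) !
  p∤k![p∸k]! p∣k![p∸k]! =
    [ prime∤! p-prime k<p , prime∤! p-prime (ℕₚ.∸-monoʳ-< 0<k (ℕₚ.<⇒≤ k<p)) ]′
      (euclidsLemma (k !) ((p ℕ.∸ k) !) p-prime p∣k![p∸k]!)

module FreshmansDream {c ℓ : Level} (S : CommutativeSemiring c ℓ) where
  open CommutativeSemiring S hiding (zero)
  open import Algebra.Properties.Semiring.Exp semiring using (_^_; ^-congˡ; ^-assocʳ)
  open import Algebra.Properties.Semiring.Mult semiring using (_×_; ×-congʳ; ×-assoc-*; ×1-homo-*)
  open import Algebra.Properties.Monoid.Sum +-monoid using (sum; sum-init-last; sum-cong-≋; sum-replicate-zero)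
  import Algebra.Properties.CommutativeSemiring.Binomial S as Binomial
  open import Relation.Binary.Reasoning.Setoid setoid

  ×≈×1* : ∀ n x → n × x ≈ (n × 1#) * x
  ×≈×1* n x = trans (×-congʳ n (sym (*-identityˡ x))) (sym (×-assoc-* n 1# x))

  ×1-homo-^ : ∀ p m → (p ℕ.^ m) × 1# ≈ (p × 1#) ^ m
  ×1-homo-^ p zero    = +-identityʳ 1#
  ×1-homo-^ p (suc m) = trans (×1-homo-* p (p ℕ.^ m)) (*-congˡ (×1-homo-^ p m))

  ^-distrib-+-if-binomials-vanish : ∀ n → (∀ j → 0 < j → j < suc n → (suc n C j) × 1# ≈ 0#) →
    ∀ x y → (x + y) ^ suc n ≈ x ^ suc n + y ^ suc n
  ^-distrib-+-if-binomials-vanish n vanish x y = begin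
    (x + y) ^ suc n                                      ≈⟨ Binomial.theorem (suc n) x y ⟩
    term Fin.zero + sum (λ i → term (Fin.suc i))         ≈⟨ +-congˡ (sum-init-last (λ i → term (Fin.suc i))) ⟩
    term Fin.zero + (sum (λ i → term (Fin.suc (inject₁ i))) + term (Fin.suc (fromℕ n)))
      ≈⟨ +-cong first (+-cong (trans (sum-cong-≋ middle) (sum-replicate-zero n)) last) ⟩
    y ^ suc n + (0# + x ^ suc n)                         ≈⟨ +-comm _ _ ⟩
    (0# + x ^ suc n) + y ^ suc n                         ≈⟨ +-congʳ (+-identityˡ _) ⟩
    x ^ suc n + y ^ suc n                                ∎
    where
    term binomial : Fin (suc (suc n)) → Carrier
    term     = Binomial.binomialTerm x y (suc n)
    binomial = Binomial.binomial x y (suc n)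

    first : term Fin.zero ≈ y ^ suc n
    first = trans (+-identityʳ _) (*-identityˡ _)

    middle : ∀ i → term (Fin.suc (inject₁ i)) ≈ 0#
    middle i = begin
      term k                             ≈⟨ ×≈×1* (suc n C toℕ k) (binomial k) ⟩
      (suc n C toℕ k) × 1# * binomial k  ≈⟨ *-congʳ (vanish (toℕ k) (s≤s z≤n) k<1+n) ⟩
      0# * binomial k                    ≈⟨ zeroˡ (binomial k) ⟩
      0#                                 ∎
      where
      k = Fin.suc (inject₁ i)
      k<1+n : toℕ k < suc n
      k<1+n = s≤s (≡.subst (_< n) (≡.sym (toℕ-inject₁ i)) (toℕ<n i))

    termAt : ℕ → Carrier
    termAt m = (suc n C m) × (x ^ m * y ^ (suc n ℕ.∸ m))

    last : term (Fin.suc (fromℕ n)) ≈ x ^ suc n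
    last = begin
      term (Fin.suc (fromℕ n))   ≡⟨ ≡.cong (termAt ∘ suc) (toℕ-fromℕ n) ⟩
      termAt (suc n)             ≡⟨ ≡.cong₂ (λ a b → a × (x ^ suc n * y ^ b)) (nCn≡1 (suc n)) (ℕₚ.n∸n≡0 n) ⟩
      1 × (x ^ suc n * 1#)       ≈⟨ trans (+-identityʳ _) (*-identityʳ _) ⟩
      x ^ suc n                  ∎

  m×1≈0-if-p∣m : ∀ {p m} → p × 1# ≈ 0# → p ∣ m → m × 1# ≈ 0#
  m×1≈0-if-p∣m {p} p×1≈0 (divides-refl d) = begin
    (d ℕ.* p) × 1#          ≈⟨ ×1-homo-* d p ⟩
    (d × 1#) * (p × 1#)     ≈⟨ *-congˡ p×1≈0 ⟩
    (d × 1#) * 0#           ≈⟨ zeroʳ _ ⟩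
    0#                      ∎

  ^p-distrib-+ : ∀ {p} → Prime p → p × 1# ≈ 0# → ∀ x y → (x + y) ^ p ≈ x ^ p + y ^ p
  ^p-distrib-+ {zero}  p-prime = contradiction p-prime ¬prime[0]
  ^p-distrib-+ {suc n} p-prime p×1≈0 = ^-distrib-+-if-binomials-vanish n
    (λ j 0<j j<p → m×1≈0-if-p∣m p×1≈0 (prime∣C p-prime 0<j j<p))

  ^p^j-distrib-+ : ∀ {p} → Prime p → p × 1# ≈ 0# → ∀ j x y →
    (x + y) ^ (p ℕ.^ j) ≈ x ^ (p ℕ.^ j) + y ^ (p ℕ.^ j)
  ^p^j-distrib-+ p-prime p×1≈0 zero x y =
    trans (*-identityʳ _) (sym (+-cong (*-identityʳ x) (*-identityʳ y)))
  ^p^j-distrib-+ {p} p-prime p×1≈0 (suc j) x y = begin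
    (x + y) ^ (p ℕ.* p ℕ.^ j)                 ≈⟨ ^-assocʳ (x + y) p (p ℕ.^ j) ⟨
    ((x + y) ^ p) ^ (p ℕ.^ j)                 ≈⟨ ^-congˡ (p ℕ.^ j) (^p-distrib-+ p-prime p×1≈0 x y) ⟩
    (x ^ p + y ^ p) ^ (p ℕ.^ j)               ≈⟨ ^p^j-distrib-+ p-prime p×1≈0 j (x ^ p) (y ^ p) ⟩
    (x ^ p) ^ (p ℕ.^ j) + (y ^ p) ^ (p ℕ.^ j) ≈⟨ +-cong (^-assocʳ x p (p ℕ.^ j)) (^-assocʳ y p (p ℕ.^ j)) ⟩
    x ^ (p ℕ.* p ℕ.^ j) + y ^ (p ℕ.* p ℕ.^ j) ∎

module _ {a ℓ : Level} (S : Setoid a ℓ) where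
  open Setoid S

  lookup-injective : ∀ {xs : List Carrier} → AllPairs (λ x y → ¬ x ≈ y) xs →
    ∀ i j → lookup xs i ≈ lookup xs j → i ≡ j
  lookup-injective (_   ∷ _)  Fin.zero    Fin.zero    _  = ≡.refl
  lookup-injective (x≉ ∷ _)   Fin.zero    (Fin.suc j) eq = contradiction eq (All.lookup x≉ (∈-lookup j))
  lookup-injective (x≉ ∷ _)   (Fin.suc i) Fin.zero    eq = contradiction (sym eq) (All.lookup x≉ (∈-lookup i))
  lookup-injective (_   ∷ xs) (Fin.suc i) (Fin.suc j) eq = ≡.cong Fin.suc (lookup-injective xs i j eq)

module FiniteField {c ℓ : Level} {F : CommutativeRing c ℓ} {n : ℕ} (FF : IsFiniteFieldOfOrder F n) where
  open CommutativeRing F hiding (zero)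
  open IsFiniteFieldOfOrder FF
  open import Algebra.Properties.Ring ring
    using (+-identityʳ-unique; //-rightDividesˡ; //-rightDividesʳ; [y-z]x≈yx-zx; x∙y⁻¹≈ε⇒x≈y; x≈y⇒x∙y⁻¹≈ε)
  open import Algebra.Properties.Semiring.Exp semiring using (_^_)
  open import Algebra.Properties.Semiring.Mult semiring using (_×_)
  import Algebra.Properties.CommutativeMonoid.Sum +-commutativeMonoid as Σ
  open FreshmansDream commutativeSemiring using (×1-homo-^)
  open import Relation.Binary.Reasoning.Setoid setoid

  private
    element : Fin (length enum) → Carrier
    element = lookup enum

    index : Carrier → Fin (length enum)
    index x = Any.index (enum-complete x)

    x≈element[index] : ∀ x → x ≈ element (index x)
    x≈element[index] x = lookup-index (enum-complete x)

    index-≈element : ∀ {x} i → x ≈ element i → index x ≡ i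
    index-≈element i x≈eᵢ = lookup-injective setoid enum-distinct _ _ (trans (sym (x≈element[index] _)) x≈eᵢ)

    index-cong : ∀ {x y} → x ≈ y → index x ≡ index y
    index-cong {y = y} x≈y = index-≈element (index y) (trans x≈y (x≈element[index] y))

    successor : Fin (length enum) → Fin (length enum)
    successor i = index (element i + 1#)

    predecessor : Fin (length enum) → Fin (length enum)
    predecessor i = index (element i - 1#)

    translation : Permutation (length enum) (length enum)
    translation = permutation successor predecessor
      (λ i → index-≈element i (trans (+-congʳ (sym (x≈element[index] _))) (//-rightDividesˡ 1# (element i))))
      (λ i → index-≈element i (trans (+-congʳ (sym (x≈element[index] _))) (//-rightDividesʳ 1# (element i))))

  infix 4 _≈?_
  _≈?_ : Decidable _≈_
  x ≈? y = map′ (index-injective setoid (enum-complete x) (enum-complete y)) index-cong (index x Fin.≟ index y)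

  -- Translating the enumeration by 1 permutes it, so Σ x = Σ (x + 1) = Σ x + n · 1.
  n×1≈0 : n × 1# ≈ 0#
  n×1≈0 = +-identityʳ-unique (Σ.sum element) (n × 1#) (begin
    Σ.sum element + n × 1#                          ≡⟨ ≡.cong (λ m → Σ.sum element + m × 1#) enum-length ⟨
    Σ.sum element + length enum × 1#                ≈⟨ +-congˡ (Σ.sum-replicate (length enum)) ⟨
    Σ.sum element + Σ.sum {length enum} (λ _ → 1#)  ≈⟨ Σ.∑-distrib-+ element (λ _ → 1#) ⟨
    Σ.sum (λ i → element i + 1#)                    ≈⟨ Σ.sum-cong-≋ (λ i → x≈element[index] (element i + 1#)) ⟩
    Σ.sum (λ i → element (successor i))             ≈⟨ Σ.∑-permute element translation ⟨
    Σ.sum element                                   ∎)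

  x≉0∧xy≈0⇒y≈0 : ∀ {x y} → ¬ x ≈ 0# → x * y ≈ 0# → y ≈ 0#
  x≉0∧xy≈0⇒y≈0 {x} {y} x≉0 xy≈0 = begin
    y               ≈⟨ *-identityˡ y ⟨
    1# * y          ≈⟨ *-congʳ (trans (*-comm x⁻¹ x) (proj₂ (inverse x x≉0))) ⟨
    (x⁻¹ * x) * y   ≈⟨ *-assoc x⁻¹ x y ⟩
    x⁻¹ * (x * y)   ≈⟨ *-congˡ xy≈0 ⟩
    x⁻¹ * 0#        ≈⟨ zeroʳ x⁻¹ ⟩
    0#              ∎
    where
    x⁻¹ : Carrier
    x⁻¹ = proj₁ (inverse x x≉0)

  x≉0∧y≉0⇒xy≉0 : ∀ {x y} → ¬ x ≈ 0# → ¬ y ≈ 0# → ¬ x * y ≈ 0#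
  x≉0∧y≉0⇒xy≉0 x≉0 y≉0 xy≈0 = y≉0 (x≉0∧xy≈0⇒y≈0 x≉0 xy≈0)

  x≉0⇒x^m≉0 : ∀ {x} → ¬ x ≈ 0# → ∀ m → ¬ x ^ m ≈ 0#
  x≉0⇒x^m≉0 x≉0 zero    = 1≉0
  x≉0⇒x^m≉0 x≉0 (suc m) = x≉0∧y≉0⇒xy≉0 x≉0 (x≉0⇒x^m≉0 x≉0 m)

  x^m≈0⇒x≈0 : ∀ {x} m → x ^ m ≈ 0# → x ≈ 0#
  x^m≈0⇒x≈0 {x} m x^m≈0 with x ≈? 0#
  ... | yes x≈0 = x≈0
  ... | no  x≉0 = contradiction x^m≈0 (x≉0⇒x^m≉0 x≉0 m)

  *-cancelʳ-nonZero : ∀ {x y z} → ¬ z ≈ 0# → x * z ≈ y * z → x ≈ y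
  *-cancelʳ-nonZero {x} {y} {z} z≉0 xz≈yz = x∙y⁻¹≈ε⇒x≈y x y (x≉0∧xy≈0⇒y≈0 z≉0 (begin
    z * (x - y)     ≈⟨ *-comm z (x - y) ⟩
    (x - y) * z     ≈⟨ [y-z]x≈yx-zx z x y ⟩
    x * z - y * z   ≈⟨ x≈y⇒x∙y⁻¹≈ε xz≈yz ⟩
    0#              ∎))

  order≡p^[1+m]⇒p×1≈0 : ∀ p m → n ≡ p ℕ.^ suc m → p × 1# ≈ 0#
  order≡p^[1+m]⇒p×1≈0 p m n≡p^[1+m] = x^m≈0⇒x≈0 (suc m) (begin
    (p × 1#) ^ suc m        ≈⟨ ×1-homo-^ p (suc m) ⟨
    (p ℕ.^ suc m) × 1#      ≡⟨ ≡.cong (_× 1#) n≡p^[1+m] ⟨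
    n × 1#                  ≈⟨ n×1≈0 ⟩
    0#                      ∎)

module Differences {c ℓ : Level} (F : CommutativeRing c ℓ) where
  private
    R : AlmostCommutativeRing c ℓ
    R = fromCommutativeRing F (λ _ → nothing)

    module Solved where
      open AlmostCommutativeRing R
      distrib-pair : ∀ a b c d → (a + b) * (c + d) ≈ (a * c + b * d) + (a * d + b * c)
      distrib-pair = solve-∀ R

  open CommutativeRing F
  open Solved
  open import Algebra.Properties.Ring ring using (-‿distribˡ-*; -‿distribʳ-*; -‿involutive; -‿+-comm)
  open import Algebra.Properties.CommutativeSemigroup +-commutativeSemigroup using (interchange)
  open import Relation.Binary.Reasoning.Setoid setoid

  -x*-y≈x*y : ∀ x y → - x * - y ≈ x * y
  -x*-y≈x*y x y = begin
    - x * - y     ≈⟨ -‿distribˡ-* x (- y) ⟨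
    - (x * - y)   ≈⟨ -‿cong (-‿distribʳ-* x y) ⟨
    - - (x * y)   ≈⟨ -‿involutive (x * y) ⟩
    x * y         ∎

  [a-b]+[c-d]≈[a+c]-[b+d] : ∀ a b c d → (a - b) + (c - d) ≈ (a + c) - (b + d)
  [a-b]+[c-d]≈[a+c]-[b+d] a b c d = trans (interchange a (- b) c (- d)) (+-congˡ (-‿+-comm b d))

  [a-b][c-d]≈[ac+bd]-[ad+bc] : ∀ a b c d → (a - b) * (c - d) ≈ (a * c + b * d) - (a * d + b * c)
  [a-b][c-d]≈[ac+bd]-[ad+bc] a b c d = begin
    (a - b) * (c - d)                           ≈⟨ distrib-pair a (- b) c (- d) ⟩
    (a * c + - b * - d) + (a * - d + - b * c)   ≈⟨ +-cong (+-congˡ (-x*-y≈x*y b d))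
                                                         (sym (+-cong (-‿distribʳ-* a d) (-‿distribˡ-* b c))) ⟩
    (a * c + b * d) + (- (a * d) + - (b * c))   ≈⟨ +-congˡ (-‿+-comm (a * d) (b * c)) ⟩
    (a * c + b * d) - (a * d + b * c)           ∎

  a+d≈c+b⇒a-b≈c-d : ∀ {a b c d} → a + d ≈ c + b → a - b ≈ c - d
  a+d≈c+b⇒a-b≈c-d {a} {b} {c} {d} a+d≈c+b = begin
    a - b                    ≈⟨ +-identityʳ (a - b) ⟨
    (a - b) + 0#             ≈⟨ +-congˡ (-‿inverseʳ d) ⟨
    (a - b) + (d - d)        ≈⟨ [a-b]+[c-d]≈[a+c]-[b+d] a b d d ⟩
    (a + d) - (b + d)        ≈⟨ +-cong a+d≈c+b (-‿cong (+-comm b d)) ⟩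
    (c + b) - (d + b)        ≈⟨ [a-b]+[c-d]≈[a+c]-[b+d] c d b b ⟨
    (c - d) + (b - b)        ≈⟨ +-congˡ (-‿inverseʳ b) ⟩
    (c - d) + 0#             ≈⟨ +-identityʳ (c - d) ⟩
    c - d                    ∎

module Determinant {c ℓ : Level} (F : CommutativeRing c ℓ) (q : ℕ) where
  private
    R : AlmostCommutativeRing c ℓ
    R = fromCommutativeRing F (λ _ → nothing)

    -- The solver cannot cancel negations over the coefficient ring F, so the Plücker
    -- identity is first expanded into this negation-free form.
    module Solved where
      open AlmostCommutativeRing R
      plücker-expanded : ∀ u₁ u₂ v₁ v₂ w₁ w₂ x₁ x₂ →
        ((u₁ * w₂) * (v₁ * x₂) + (u₂ * w₁) * (v₂ * x₁))
          + (((u₁ * x₂) * (v₂ * w₁) + (u₂ * x₁) * (v₁ * w₂)) + ((u₁ * v₂) * (w₂ * x₁) + (u₂ * v₁) * (w₁ * x₂)))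
        ≈ (((u₁ * x₂) * (v₁ * w₂) + (u₂ * x₁) * (v₂ * w₁)) + ((u₁ * v₂) * (w₁ * x₂) + (u₂ * v₁) * (w₂ * x₁)))
          + ((u₁ * w₂) * (v₂ * x₁) + (u₂ * w₁) * (v₁ * x₂))
      plücker-expanded = solve-∀ R

  open CommutativeRing F
  open Geometry F q
  open Differences F
  open Solved

  det-plücker : ∀ u v w x → det u w * det v x ≈ det u x * det v w + det u v * det w x
  det-plücker (u₁ , u₂) (v₁ , v₂) (w₁ , w₂) (x₁ , x₂) =
    trans ([a-b][c-d]≈[ac+bd]-[ad+bc] _ _ _ _)
      (trans (a+d≈c+b⇒a-b≈c-d (plücker-expanded u₁ u₂ v₁ v₂ w₁ w₂ x₁ x₂))
        (sym (trans (+-cong ([a-b][c-d]≈[ac+bd]-[ad+bc] _ _ _ _) ([a-b][c-d]≈[ac+bd]-[ad+bc] _ _ _ _))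
                    ([a-b]+[c-d]≈[a+c]-[b+d] _ _ _ _))))


module Frobenius {c ℓ : Level} (F : CommutativeRing c ℓ) (q : ℕ) (q-primePower : IsPrimePower q)
                 (FF : IsFiniteFieldOfOrder F (q ℕ.* q)) where
  open CommutativeRing F hiding (zero)
  open Geometry F q using (_^_)
  open FiniteField FF using (order≡p^[1+m]⇒p×1≈0)
  open FreshmansDream commutativeSemiring using (^p^j-distrib-+)
  open import Algebra.Properties.Semiring.Mult semiring using (_×_)
  import Algebra.Properties.Semiring.Exp semiring as Exp
  open import Algebra.Properties.CommutativeSemiring.Exp commutativeSemiring using (^-distrib-*)
  open import Algebra.Properties.Ring ring using (x+x≈x⇒x≈0; +-inverseʳ-unique)
  open import Relation.Binary.Reasoning.Setoid setoid

  private
    p k : ℕ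
    p = proj₁ q-primePower
    k = proj₁ (proj₂ q-primePower)

    p-prime : Prime p
    p-prime = proj₁ (proj₂ (proj₂ q-primePower))

    q≡p^[1+k] : q ≡ p ℕ.^ suc k
    q≡p^[1+k] = proj₂ (proj₂ (proj₂ q-primePower))

    p×1≈0 : p × 1# ≈ 0#
    p×1≈0 = order≡p^[1+m]⇒p×1≈0 p (k ℕ.+ suc k)
      (≡.trans (≡.cong₂ ℕ._*_ q≡p^[1+k] q≡p^[1+k]) (≡.sym (ℕₚ.^-distribˡ-+-* p (suc k) (suc k))))

  ^≡Exp^ : ∀ x m → x ^ m ≡ x Exp.^ m
  ^≡Exp^ x zero    = ≡.refl
  ^≡Exp^ x (suc m) = ≡.cong (x *_) (^≡Exp^ x m)

  φ : Carrier → Carrier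
  φ x = x ^ q

  φ≡^p^[1+k] : ∀ x → φ x ≡ x Exp.^ (p ℕ.^ suc k)
  φ≡^p^[1+k] x = ≡.trans (^≡Exp^ x q) (≡.cong (x Exp.^_) q≡p^[1+k])

  φ-cong : ∀ {x y} → x ≈ y → φ x ≈ φ y
  φ-cong {x} {y} x≈y = begin
    φ x                       ≡⟨ φ≡^p^[1+k] x ⟩
    x Exp.^ (p ℕ.^ suc k)     ≈⟨ Exp.^-congˡ (p ℕ.^ suc k) x≈y ⟩
    y Exp.^ (p ℕ.^ suc k)     ≡⟨ φ≡^p^[1+k] y ⟨
    φ y                       ∎

  φ-+ : ∀ x y → φ (x + y) ≈ φ x + φ y
  φ-+ x y = begin
    φ (x + y)                                       ≡⟨ φ≡^p^[1+k] (x + y) ⟩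
    (x + y) Exp.^ (p ℕ.^ suc k)                     ≈⟨ ^p^j-distrib-+ p-prime p×1≈0 (suc k) x y ⟩
    x Exp.^ (p ℕ.^ suc k) + y Exp.^ (p ℕ.^ suc k)   ≡⟨ ≡.cong₂ _+_ (φ≡^p^[1+k] x) (φ≡^p^[1+k] y) ⟨
    φ x + φ y                                       ∎

  φ-* : ∀ x y → φ (x * y) ≈ φ x * φ y
  φ-* x y = begin
    φ (x * y)                                       ≡⟨ φ≡^p^[1+k] (x * y) ⟩
    (x * y) Exp.^ (p ℕ.^ suc k)                     ≈⟨ ^-distrib-* x y (p ℕ.^ suc k) ⟩
    x Exp.^ (p ℕ.^ suc k) * y Exp.^ (p ℕ.^ suc k)   ≡⟨ ≡.cong₂ _*_ (φ≡^p^[1+k] x) (φ≡^p^[1+k] y) ⟨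
    φ x * φ y                                       ∎

  φ-0 : φ 0# ≈ 0#
  φ-0 = x+x≈x⇒x≈0 (φ 0#) (trans (sym (φ-+ 0# 0#)) (φ-cong (+-identityʳ 0#)))

  φ-1 : φ 1# ≈ 1#
  φ-1 = 1^n≈1 q
    where
    1^n≈1 : ∀ n → 1# ^ n ≈ 1#
    1^n≈1 zero    = refl
    1^n≈1 (suc n) = trans (*-identityˡ _) (1^n≈1 n)

  φ-neg : ∀ x → φ (- x) ≈ - φ x
  φ-neg x = +-inverseʳ-unique (φ x) (φ (- x))
    (trans (sym (φ-+ x (- x))) (trans (φ-cong (-‿inverseʳ x)) φ-0))

open Product using (_×_)

module ConicCrossRatio {c ℓ : Level} (F : CommutativeRing c ℓ) (q : ℕ) (q-primePower : IsPrimePower q)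
                       (FF : IsFiniteFieldOfOrder F (q ℕ.* q)) where
  open CommutativeRing F
  open Geometry F q
  open IsFiniteFieldOfOrder FF using (1≉0)
  open FiniteField FF using (x≉0∧y≉0⇒xy≉0; *-cancelʳ-nonZero; x^m≈0⇒x≈0)
  open Determinant F q using (det-plücker)
  open Frobenius F q q-primePower FF
  open import Algebra.Properties.Ring ring using (+-identityʳ-unique; -‿injective; -0#≈0#; x∙y⁻¹≈ε⇒x≈y)
  open import Relation.Binary.Reasoning.Setoid setoid

  φₚ : Param → Param
  φₚ = Maybe.map φ

  -- A record rather than a definition, so that a and b can be inferred from a ↦ b.
  record _↦_ (a b : Param) : Set ℓ where
    constructor mk↦
    field φₚa≈b : φₚ a ≈ₚ b

  ≈ₚ-sym : ∀ a b → a ≈ₚ b → b ≈ₚ a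
  ≈ₚ-sym (just x) (just y) x≈y = sym x≈y
  ≈ₚ-sym nothing  nothing  _   = tt

  ≈ₚ-trans : ∀ a b c → a ≈ₚ b → b ≈ₚ c → a ≈ₚ c
  ≈ₚ-trans (just x) (just y) (just z) x≈y y≈z = trans x≈y y≈z
  ≈ₚ-trans nothing  nothing  nothing  _   _   = tt

  fixed⇒InFqParam : ∀ ξ → ξ ↦ ξ → InFqParam ξ
  fixed⇒InFqParam (just x) (mk↦ φx≈x) = φx≈x
  fixed⇒InFqParam nothing  _          = tt

  ≈ₚ-InFqParam⇒fixed : ∀ ξ η → ξ ≈ₚ η → InFqParam ξ → η ↦ η
  ≈ₚ-InFqParam⇒fixed (just x) (just y) x≈y φx≈x = mk↦ (trans (φ-cong (sym x≈y)) (trans φx≈x x≈y))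
  ≈ₚ-InFqParam⇒fixed nothing  nothing  _   _    = mk↦ tt

  φ-OnLine : ∀ L ξ → OnLine L ξ → OnLine L (φₚ ξ)
  φ-OnLine L nothing b≈0 = b≈0
  φ-OnLine (mkLine a b d a∈Fq b∈Fq d∈Fq _) (just x) ax+bxx+d≈0 = begin
    a * φ x + b * (φ x * φ x) + d          ≈⟨ +-cong (+-cong (*-congʳ a∈Fq) (*-congʳ b∈Fq)) d∈Fq ⟨
    φ a * φ x + φ b * (φ x * φ x) + φ d    ≈⟨ +-congʳ (+-cong (φ-* a x) φ[bxx]) ⟨
    φ (a * x) + φ (b * (x * x)) + φ d      ≈⟨ +-congʳ (φ-+ (a * x) (b * (x * x))) ⟨
    φ (a * x + b * (x * x)) + φ d          ≈⟨ φ-+ (a * x + b * (x * x)) d ⟨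
    φ (a * x + b * (x * x) + d)            ≈⟨ φ-cong ax+bxx+d≈0 ⟩
    φ 0#                                   ≈⟨ φ-0 ⟩
    0#                                     ∎
    where
    φ[bxx] : φ (b * (x * x)) ≈ φ b * (φ x * φ x)
    φ[bxx] = trans (φ-* b (x * x)) (*-congˡ (φ-* x x))

  hyperbolic⇒fixes : ∀ {L α β} → Hyperbolic L → MeetsConicIn L α β → α ↦ α × β ↦ β
  hyperbolic⇒fixes {L} {α} {β} (ξ₁ , ξ₂ , ξ₁∈Fq , ξ₂∈Fq , ξ₁≉ξ₂ , ξ₁∈L , ξ₂∈L , _) (_ , _ , _ , only-α-β)
    with only-α-β ξ₁ ξ₁∈L | only-α-β ξ₂ ξ₂∈L
  ... | inj₁ ξ₁≈α | inj₂ ξ₂≈β = ≈ₚ-InFqParam⇒fixed ξ₁ α ξ₁≈α ξ₁∈Fq , ≈ₚ-InFqParam⇒fixed ξ₂ β ξ₂≈β ξ₂∈Fq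
  ... | inj₂ ξ₁≈β | inj₁ ξ₂≈α = ≈ₚ-InFqParam⇒fixed ξ₂ α ξ₂≈α ξ₂∈Fq , ≈ₚ-InFqParam⇒fixed ξ₁ β ξ₁≈β ξ₁∈Fq
  ... | inj₁ ξ₁≈α | inj₁ ξ₂≈α = contradiction (≈ₚ-trans ξ₁ α ξ₂ ξ₁≈α (≈ₚ-sym ξ₂ α ξ₂≈α)) ξ₁≉ξ₂
  ... | inj₂ ξ₁≈β | inj₂ ξ₂≈β = contradiction (≈ₚ-trans ξ₁ β ξ₂ ξ₁≈β (≈ₚ-sym ξ₂ β ξ₂≈β)) ξ₁≉ξ₂

  elliptic⇒swaps : ∀ {L α β} → Elliptic L → MeetsConicIn L α β → α ↦ β × β ↦ α
  elliptic⇒swaps {L} {α} {β} elliptic (_ , α∈L , β∈L , only-α-β) =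
    [ (λ α↦α → contradiction α∈L (notFixed α (mk↦ α↦α))) , mk↦ ]′ (only-α-β (φₚ α) (φ-OnLine L α α∈L)) ,
    [ mk↦ , (λ β↦β → contradiction β∈L (notFixed β (mk↦ β↦β))) ]′ (only-α-β (φₚ β) (φ-OnLine L β β∈L))
    where
    notFixed : ∀ ξ → ξ ↦ ξ → ¬ OnLine L ξ
    notFixed ξ ξ↦ξ = elliptic ξ (fixed⇒InFqParam ξ ξ↦ξ)

  infix 4 _≈₂_
  _≈₂_ : Carrier × Carrier → Carrier × Carrier → Set ℓ
  _≈₂_ = Pointwise _≈_ _≈_

  φ₂ : Carrier × Carrier → Carrier × Carrier
  φ₂ = Product.map φ φ

  det-cong : ∀ {u u′ v v′} → u ≈₂ u′ → v ≈₂ v′ → det u v ≈ det u′ v′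
  det-cong (u₁≈ , u₂≈) (v₁≈ , v₂≈) = +-cong (*-cong u₁≈ v₂≈) (-‿cong (*-cong u₂≈ v₁≈))

  φ-det : ∀ u v → φ (det u v) ≈ det (φ₂ u) (φ₂ v)
  φ-det (u₁ , u₂) (v₁ , v₂) =
    trans (φ-+ _ _) (+-cong (φ-* u₁ v₂) (trans (φ-neg _) (-‿cong (φ-* u₂ v₁))))

  φ₂-vec : ∀ {a b} → a ↦ b → φ₂ (vec a) ≈₂ vec b
  φ₂-vec {just x} {just y} (mk↦ φx≈y) = φx≈y , φ-1
  φ₂-vec {nothing} {nothing} _ = φ-1 , φ-0

  φ-det-vec : ∀ {a a′ b b′} → a ↦ a′ → b ↦ b′ → φ (det (vec a) (vec b)) ≈ det (vec a′) (vec b′)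
  φ-det-vec {a} {_} {b} a↦a′ b↦b′ = trans (φ-det (vec a) (vec b)) (det-cong (φ₂-vec a↦a′) (φ₂-vec b↦b′))

  φ₂-crossRatioHom : ∀ {α β γ δ α′ β′ γ′ δ′} → α ↦ α′ → β ↦ β′ → γ ↦ γ′ → δ ↦ δ′ →
    φ₂ (crossRatioHom α β γ δ) ≈₂ crossRatioHom α′ β′ γ′ δ′
  φ₂-crossRatioHom α↦ β↦ γ↦ δ↦ =
    trans (φ-* _ _) (*-cong (φ-det-vec α↦ γ↦) (φ-det-vec β↦ δ↦)) ,
    trans (φ-* _ _) (*-cong (φ-det-vec α↦ δ↦) (φ-det-vec β↦ γ↦))

  ≈₂-trans : ∀ {r s t} → r ≈₂ s → s ≈₂ t → r ≈₂ t
  ≈₂-trans (r₁≈s₁ , r₂≈s₂) (s₁≈t₁ , s₂≈t₂) = trans r₁≈s₁ s₁≈t₁ , trans r₂≈s₂ s₂≈t₂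

  crossRatioHom-swap-both : ∀ α β γ δ → crossRatioHom β α δ γ ≈₂ crossRatioHom α β γ δ
  crossRatioHom-swap-both _ _ _ _ = *-comm _ _ , *-comm _ _

  crossRatioHom-swap-first : ∀ α β γ δ → crossRatioHom β α γ δ ≈₂ swap (crossRatioHom α β γ δ)
  crossRatioHom-swap-first _ _ _ _ = *-comm _ _ , *-comm _ _

  sameType⇒crossRatio-fixed : ∀ L M α β γ δ → SameType L M → MeetsConicIn L α β → MeetsConicIn M γ δ →
    φ₂ (crossRatioHom α β γ δ) ≈₂ crossRatioHom α β γ δ
  sameType⇒crossRatio-fixed _ _ _ _ _ _ (inj₁ (hypL , hypM)) L∩𝒪 M∩𝒪
    with hyperbolic⇒fixes hypL L∩𝒪 | hyperbolic⇒fixes hypM M∩𝒪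
  ... | α↦α , β↦β | γ↦γ , δ↦δ = φ₂-crossRatioHom α↦α β↦β γ↦γ δ↦δ
  sameType⇒crossRatio-fixed _ _ α β γ δ (inj₂ (ellL , ellM)) L∩𝒪 M∩𝒪
    with elliptic⇒swaps ellL L∩𝒪 | elliptic⇒swaps ellM M∩𝒪
  ... | α↦β , β↦α | γ↦δ , δ↦γ = ≈₂-trans (φ₂-crossRatioHom α↦β β↦α γ↦δ δ↦γ) (crossRatioHom-swap-both α β γ δ)

  differentType⇒crossRatio-swapped : ∀ L M α β γ δ → DifferentType L M →
    MeetsConicIn L α β → MeetsConicIn M γ δ → φ₂ (crossRatioHom α β γ δ) ≈₂ swap (crossRatioHom α β γ δ)
  differentType⇒crossRatio-swapped _ _ _ _ _ _ (inj₁ (hypL , ellM)) L∩𝒪 M∩𝒪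
    with hyperbolic⇒fixes hypL L∩𝒪 | elliptic⇒swaps ellM M∩𝒪
  ... | α↦α , β↦β | γ↦δ , δ↦γ = φ₂-crossRatioHom α↦α β↦β γ↦δ δ↦γ
  differentType⇒crossRatio-swapped _ _ α β γ δ (inj₂ (ellL , hypM)) L∩𝒪 M∩𝒪
    with elliptic⇒swaps ellL L∩𝒪 | hyperbolic⇒fixes hypM M∩𝒪
  ... | α↦β , β↦α | γ↦γ , δ↦δ = ≈₂-trans (φ₂-crossRatioHom α↦β β↦α γ↦γ δ↦δ) (crossRatioHom-swap-first α β γ δ)

  det-vec≈0⇒≈ₚ : ∀ a b → det (vec a) (vec b) ≈ 0# → a ≈ₚ b
  det-vec≈0⇒≈ₚ (just x) (just y) det≈0 =
    x∙y⁻¹≈ε⇒x≈y x y (trans (sym (+-cong (*-identityʳ x) (-‿cong (*-identityˡ y)))) det≈0)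
  det-vec≈0⇒≈ₚ (just x) nothing det≈0 = contradiction (-‿injective (begin
    - 1#                     ≈⟨ +-identityˡ (- 1#) ⟨
    0# + - 1#                ≈⟨ +-cong (zeroʳ x) (-‿cong (*-identityˡ 1#)) ⟨
    x * 0# + - (1# * 1#)     ≈⟨ det≈0 ⟩
    0#                       ≈⟨ -0#≈0# ⟨
    - 0#                     ∎)) 1≉0
  det-vec≈0⇒≈ₚ nothing (just y) det≈0 = contradiction (begin
    1#                       ≈⟨ +-identityʳ 1# ⟨
    1# + 0#                  ≈⟨ +-cong (*-identityˡ 1#) (trans (-‿cong (zeroˡ y)) -0#≈0#) ⟨
    1# * 1# + - (0# * y)     ≈⟨ det≈0 ⟩
    0#                       ∎) 1≉0
  det-vec≈0⇒≈ₚ nothing nothing _ = tt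

  crossRatioHom-nondegenerate : ∀ α β γ δ → ¬ α ≈ₚ β → ¬ γ ≈ₚ δ →
    ¬ proj₁ (crossRatioHom α β γ δ) ≈ proj₂ (crossRatioHom α β γ δ)
  crossRatioHom-nondegenerate α β γ δ α≉β γ≉δ n≈d =
    x≉0∧y≉0⇒xy≉0 (α≉β ∘ det-vec≈0⇒≈ₚ α β) (γ≉δ ∘ det-vec≈0⇒≈ₚ γ δ)
      (+-identityʳ-unique _ _ (trans (sym (det-plücker (vec α) (vec β) (vec γ) (vec δ))) n≈d))

  represents⇒≉1 : ∀ {n d x} → ¬ n ≈ d → Represents (n , d) (just x) → ¬ x ≈ 1#
  represents⇒≉1 {n} {d} {x} n≉d (_ , n≈xd) x≈1 = n≉d (begin
    n        ≈⟨ n≈xd ⟩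
    x * d    ≈⟨ *-congʳ x≈1 ⟩
    1# * d   ≈⟨ *-identityˡ d ⟩
    d        ∎)

  fixed⇒InB0 : ∀ {r} lam → φ₂ r ≈₂ r → ¬ proj₁ r ≈ proj₂ r → Represents r lam → InB0 lam
  fixed⇒InB0 {n , d} (just x) (φn≈n , φd≈d) n≉d (d≉0 , n≈xd) =
    *-cancelʳ-nonZero d≉0 (begin
      φ x * d       ≈⟨ *-congˡ φd≈d ⟨
      φ x * φ d     ≈⟨ φ-* x d ⟨
      φ (x * d)     ≈⟨ φ-cong n≈xd ⟨
      φ n           ≈⟨ φn≈n ⟩
      n             ≈⟨ n≈xd ⟩
      x * d         ∎) ,
    represents⇒≉1 n≉d (d≉0 , n≈xd)
  fixed⇒InB0 nothing _ _ _ = tt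

  swapped⇒InB1 : ∀ {r} lam → φ₂ r ≈₂ swap r → ¬ proj₁ r ≈ proj₂ r → Represents r lam → InB1 lam
  swapped⇒InB1 {n , d} (just x) (φn≈d , φd≈n) n≉d (d≉0 , n≈xd) =
    represents⇒≉1 n≉d (d≉0 , n≈xd) ,
    *-cancelʳ-nonZero d≉0 (begin
      (φ x * x) * d   ≈⟨ *-assoc (φ x) x d ⟩
      φ x * (x * d)   ≈⟨ *-congˡ (trans (sym n≈xd) (sym φd≈n)) ⟩
      φ x * φ d       ≈⟨ φ-* x d ⟨
      φ (x * d)       ≈⟨ φ-cong n≈xd ⟨
      φ n             ≈⟨ φn≈d ⟩
      d               ≈⟨ *-identityˡ d ⟨
      1# * d          ∎)
  swapped⇒InB1 {n , d} nothing (φn≈d , _) _ (n≉0 , d≈0) =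
    contradiction (x^m≈0⇒x≈0 q (≡.subst (_≈ 0#) (^≡Exp^ n q) (trans φn≈d d≈0))) n≉0

  fixed⇒InB0-⊎ : ∀ {r lam} → φ₂ r ≈₂ r → ¬ proj₁ r ≈ proj₂ r →
    Represents r lam ⊎ Represents (swap r) lam → InB0 lam
  fixed⇒InB0-⊎ {lam = lam} fixed n≉d =
    [ fixed⇒InB0 lam fixed n≉d , fixed⇒InB0 lam (Product.swap fixed) (n≉d ∘ sym) ]′

  swapped⇒InB1-⊎ : ∀ {r lam} → φ₂ r ≈₂ swap r → ¬ proj₁ r ≈ proj₂ r →
    Represents r lam ⊎ Represents (swap r) lam → InB1 lam
  swapped⇒InB1-⊎ {lam = lam} swapped n≉d =
    [ swapped⇒InB1 lam swapped n≉d , swapped⇒InB1 lam (Product.swap swapped) (n≉d ∘ sym) ]′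

mainTheorem6 : ∀ {c ℓ : Level} (F : CommutativeRing c ℓ) (q : ℕ) →
    IsPrimePower q → IsFiniteFieldOfOrder F (q ℕ.* q) →
    let open Geometry F q in
    ∀ (L M : Line) → NonTangent L → NonTangent M → ¬ SameLine L M →
    ∀ (α β γ δ lam : Param) →
    MeetsConicIn L α β → MeetsConicIn M γ δ →
    (Represents (crossRatioHom α β γ δ) lam ⊎ Represents (swap (crossRatioHom α β γ δ)) lam) →
    (SameType L M → InB0 lam) × (DifferentType L M → InB1 lam)
mainTheorem6 F q q-primePower FF L M _ _ _ α β γ δ lam L∩𝒪 M∩𝒪 represents =
  sameType⇒InB0 , differentType⇒InB1
  where
  open CommutativeRing F using (_≈_)
  open Geometry F q
  open ConicCrossRatio F q q-primePower FF

  n≉d : ¬ proj₁ (crossRatioHom α β γ δ) ≈ proj₂ (crossRatioHom α β γ δ)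
  n≉d = crossRatioHom-nondegenerate α β γ δ (proj₁ L∩𝒪) (proj₁ M∩𝒪)

  sameType⇒InB0 : SameType L M → InB0 lam
  sameType⇒InB0 same =
    fixed⇒InB0-⊎ (sameType⇒crossRatio-fixed L M α β γ δ same L∩𝒪 M∩𝒪) n≉d represents

  differentType⇒InB1 : DifferentType L M → InB1 lam
  differentType⇒InB1 different =
    swapped⇒InB1-⊎ (differentType⇒crossRatio-swapped L M α β γ δ different L∩𝒪 M∩𝒪) n≉d represents
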